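{- Let $X,Y$ be $\mathfrak{Q}$-preordered $\mathfrak{Q}$-subsets and let $f\colon X\to Y$, $g\colon Y\to X$ be $\mathfrak{Q}$-order-preserving maps. The following are equivalent: (i) $f\dashv g$ is a $\mathfrak{Q}$-Galois connection; (ii) $(f_\natural)_\uparrow\dashv (g^\natural)^\downarrow$ is a $\mathfrak{Q}$-Galois connection between $\mathsf{P}X$ and $\mathsf{P}^\dagger Y$ (i.e. a $\mathfrak{Q}$-polarity from $X$ to $Y$); (iii) $(f_\natural)^*\dashv (g^\natural)_*$ is a $\mathfrak{Q}$-Galois connection between $\mathsf{P}Y$ and $\mathsf{P}X$ (i.e. a $\mathfrak{Q}$-axiality from $Y$ to $X$); (iv) $(f_\natural)_\dagger\dashv (g^\natural)^\dagger$ is a $\mathfrak{Q}$-Galois connection between $\mathsf{P}^\dagger Y$ and $\mathsf{P}^\dagger X$ (i.e. a dual $\mathfrak{Q}$-axiality from $Y$ to $X$). Here $f_\natural\colon X\nrightarrow Y$ and $g^\natural\colon X\nrightarrow Y$ are the $\mathfrak{Q}$-distributors $f_\natural(x,y)=1_Y^\natural(fx,y)$ and $g^\natural(x,y)=1_X^\natural(x,gy)$.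
   Context: $(\mathfrak{Q},\&,e)$ is a unital quantale (complete lattice with an associative multiplication $\&$ with unit $e$, distributing over arbitrary joins in each variable), assumed non-trivial ($\bot<e$). Implications are defined by $p\& q\le r\iff p\le r/q\iff q\le p\backslash r$. Put $\mathcal{D}\mathfrak{Q}(p,q)=\{u\in\mathfrak{Q}: (u/p)\& p=u=q\&(q\backslash u)\}$. A $\mathfrak{Q}$-subset is a set $X$ with a map $|\cdot|\colon X\to\mathfrak{Q}$. A $\mathfrak{Q}$-relation $\phi\colon X\nrightarrow Y$ is a map $\phi\colon X\times Y\to\mathfrak{Q}$ with $\phi(x,y)\in\mathcal{D}\mathfrak{Q}(|x|,|y|)$. Composition: $(\psi\circ\phi)(x,z)=\bigvee_{y\in Y}(\psi(y,z)/|y|)\&\phi(x,y)$; identity $\mathrm{id}_X(x,x')=|x|$ if $x=x'$ and $\bot$ otherwise; relations $X\nrightarrow Y$ are ordered pointwise. For $\phi\colon X\nrightarrow Y$, $\psi\colon Y\nrightarrow Z$, $\xi\colon X\nrightarrow Z$: $\xi\swarrow\phi$ is the join of all $\psi'\colon Y\nrightarrow Z$ with $\psi'\circ\phi\le\xi$, and $\psi\searrow\xi$ is the join of all $\phi'\colon X\nrightarrow Y$ with $\psi\circ\phi'\le\xi$. $\mathbf{1}_q$ denotes the singleton $\{*\}$ with $|*|=q$ (and discrete preorder $\mathrm{id}$); a relation $\mathbf{1}_p\nrightarrow\mathbf{1}_q$ is identified with an element of $\mathcal{D}\mathfrak{Q}(p,q)$. A $\mathfrak{Q}$-preordered $\mathfrak{Q}$-subset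 is a $\mathfrak{Q}$-subset $X$ with a $\mathfrak{Q}$-relation $1_X^\natural\colon X\nrightarrow X$ such that $\mathrm{id}_X\le 1_X^\natural$ and $1_X^\natural\circ 1_X^\natural\le 1_X^\natural$. A map $f\colon X\to Y$ is $\mathfrak{Q}$-order-preserving if $|fx|=|x|$ and $1_X^\natural(x,x')\le 1_Y^\natural(fx,fx')$ for all $x,x'$. The underlying preorder: $x\le y$ iff $|x|=|y|$ and $|x|\le 1_X^\natural(x,y)$; maps are compared by $f\le g$ iff $fx\le gx$ for all $x$. A $\mathfrak{Q}$-Galois connection $f\dashv g$ consists of $\mathfrak{Q}$-order-preserving $f\colon X\to Y$, $g\colon Y\to X$ with $1_X\le gf$ and $fg\le 1_Y$. A $\mathfrak{Q}$-distributor $\phi\colon X\nrightarrow Y$ is a $\mathfrak{Q}$-relation with $1_Y^\natural\circ\phi\circ 1_X^\natural\le\phi$. $\mathsf{P}X$ is the set of all $\mathfrak{Q}$-relations $\mu\colon X\nrightarrow\mathbf{1}_q$ ($q\in\mathfrak{Q}$) with $\mu\circ 1_X^\natural\le\mu$, with $|\mu|=q$ and $1_{\mathsf{P}X}^\natural(\mu,\mu')=\mu'\swarrow\mu$. $\mathsf{P}^\dagger X$ is the set of all $\lambda\colon\mathbf{1}_q\nrightarrow X$ with $1_X^\natural\circ\lambda\le\lambda$, with $|\lambda|=q$ and $1_{\mathsf{P}^\dagger X}^\natural(\lambda,\lambda')=\lambda'\searrow\lambda$. For a $\mathfrak{Q}$-distributor $\phi\colon X\nrightarrow Y$ define $\phi_\uparrow\colon\mathsf{P}X\to\mathsf{P}^\dagger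 Y$, $\mu\mapsto\phi\swarrow\mu$; $\phi^\downarrow\colon\mathsf{P}^\dagger Y\to\mathsf{P}X$, $\lambda'\mapsto\lambda'\searrow\phi$; $\phi^*\colon\mathsf{P}Y\to\mathsf{P}X$, $\mu'\mapsto\mu'\circ\phi$; $\phi_*\colon\mathsf{P}X\to\mathsf{P}Y$, $\mu\mapsto\mu\swarrow\phi$; $\phi_\dagger\colon\mathsf{P}^\dagger Y\to\mathsf{P}^\dagger X$, $\lambda'\mapsto\phi\searrow\lambda'$; $\phi^\dagger\colon\mathsf{P}^\dagger X\to\mathsf{P}^\dagger Y$, $\lambda\mapsto\phi\circ\lambda$. -}

module Defs where

open import Level using (Level; _⊔_; Lift; lift) renaming (suc to lsuc)
open import Data.Product using (Σ; _×_; _,_; proj₁; proj₂)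
open import Data.Unit.Polymorphic using (⊤; tt)
open import Data.Empty.Polymorphic using (⊥)
open import Relation.Binary.PropositionalEquality using (_≡_)
open import Relation.Nullary using (¬_)
open import Function.Bundles using (_⇔_)

-- The implications _/_ and _\_ are given as the
-- residuals of & (uniquely determined by the adjunction laws).

record Quantale (ℓ : Level) : Set (lsuc ℓ) where
  infixl 7 _&_
  infix 4 _≤_
  field
    Carrier  : Set ℓ
    _≤_      : Carrier → Carrier → Set ℓ
    ≤-refl   : ∀ {p} → p ≤ p
    ≤-trans  : ∀ {p q r} → p ≤ q → q ≤ r → p ≤ r
    ≤-antisym : ∀ {p q} → p ≤ q → q ≤ p → p ≡ q
    ⋁        : {I : Set ℓ} → (I → Carrier) → Carrier
    ⋁-ub     : ∀ {I : Set ℓ} (u : I → Carrier) (i : I) → u i ≤ ⋁ u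
    ⋁-least  : ∀ {I : Set ℓ} (u : I → Carrier) (p : Carrier) →
               (∀ i → u i ≤ p) → ⋁ u ≤ p
    _&_      : Carrier → Carrier → Carrier
    e        : Carrier
    &-assoc  : ∀ p q r → (p & q) & r ≡ p & (q & r)
    &-identityˡ : ∀ p → e & p ≡ p
    &-identityʳ : ∀ p → p & e ≡ p
    &-distribˡ-⋁ : ∀ p {I : Set ℓ} (u : I → Carrier) → p & ⋁ u ≡ ⋁ (λ i → p & u i)
    &-distribʳ-⋁ : ∀ p {I : Set ℓ} (u : I → Carrier) → ⋁ u & p ≡ ⋁ (λ i → u i & p)
    _/_      : Carrier → Carrier → Carrier
    _\\_     : Carrier → Carrier → Carrier
    /-adj    : ∀ p q r → (p & q ≤ r) ⇔ (p ≤ r / q)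
    \\-adj   : ∀ p q r → (p & q ≤ r) ⇔ (q ≤ p \\ r)

  ⊥Q : Carrier
  ⊥Q = ⋁ {I = ⊥} (λ ())

Nontrivial : ∀ {ℓ} → Quantale ℓ → Set ℓ
Nontrivial Q = ¬ (e ≡ ⊥Q)
  where open Quantale Q

module _ {ℓ : Level} (Q : Quantale ℓ) where
  open Quantale Q

  DQ : Carrier → Carrier → Carrier → Set ℓ
  DQ p q u = ((u / p) & p ≡ u) × (q & (q \\ u) ≡ u)

  record QSubset : Set (lsuc ℓ) where
    constructor qsubset
    field
      Car : Set ℓ
      ∣_∣ : Car → Carrier
  open QSubset public

  𝟏 : Carrier → QSubset
  𝟏 q = qsubset ⊤ (λ _ → q)

  Rel : QSubset → QSubset → Set ℓ
  Rel X Y = Car X → Car Y → Carrier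

  IsQRel : (X Y : QSubset) → Rel X Y → Set ℓ
  IsQRel X Y φ = ∀ x y → DQ (∣ X ∣ x) (∣ Y ∣ y) (φ x y)

  LeR : (X Y : QSubset) → Rel X Y → Rel X Y → Set ℓ
  LeR X Y φ ψ = ∀ x y → φ x y ≤ ψ x y

  comp : (X Y Z : QSubset) → Rel Y Z → Rel X Y → Rel X Z
  comp X Y Z ψ φ x z = ⋁ {I = Car Y} (λ y → (ψ y z / ∣ Y ∣ y) & φ x y)

  -- identity: id(x,x') = |x| if x = x', ⊥ otherwise
  -- (written as the join over the proposition x ≡ x')
  idR : (X : QSubset) → Rel X X
  idR X x x' = ⋁ {I = x ≡ x'} (λ _ → ∣ X ∣ x)

  lift↙ : (X Y Z : QSubset) → Rel X Z → Rel X Y → Rel Y Z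
  lift↙ X Y Z ξ φ y z =
    ⋁ {I = Σ (Rel Y Z) (λ ψ' → IsQRel Y Z ψ' × LeR X Z (comp X Y Z ψ' φ) ξ)}
      (λ s → proj₁ s y z)

  ext↘ : (X Y Z : QSubset) → Rel Y Z → Rel X Z → Rel X Y
  ext↘ X Y Z ψ ξ x y =
    ⋁ {I = Σ (Rel X Y) (λ φ' → IsQRel X Y φ' × LeR X Z (comp X Y Z ψ φ') ξ)}
      (λ s → proj₁ s x y)

  -- A 𝔔-subset equipped with a 𝔔-relation 1♮ (no axioms); this is all
  -- that is needed to define order-preserving maps and Galois connections.
  record QRelSet : Set (lsuc ℓ) where
    constructor qrelset
    field
      sub : QSubset
      1♮  : Rel sub sub

  record QPreord : Set (lsuc ℓ) where
    field
      sub    : QSubset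
      1♮     : Rel sub sub
      1♮-rel : IsQRel sub sub 1♮
      1♮-refl : LeR sub sub (idR sub) 1♮
      1♮-trans : LeR sub sub (comp sub sub sub 1♮ 1♮) 1♮

    relSet : QRelSet
    relSet = qrelset sub 1♮

  module _ (A B : QRelSet) where
    private
      module A = QRelSet A
      module B = QRelSet B

    IsQOrderPreserving : (Car A.sub → Car B.sub) → Set ℓ
    IsQOrderPreserving f =
      (∀ x → ∣ B.sub ∣ (f x) ≡ ∣ A.sub ∣ x) ×
      (∀ x x' → A.1♮ x x' ≤ B.1♮ (f x) (f x'))

  Underlying≤ : (A : QRelSet) → Car (QRelSet.sub A) → Car (QRelSet.sub A) → Set ℓ
  Underlying≤ A x y = (∣ sub ∣ x ≡ ∣ sub ∣ y) × (∣ sub ∣ x ≤ 1♮ x y)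
    where open QRelSet A

  IsQGalois : (A B : QRelSet) → (Car (QRelSet.sub A) → Car (QRelSet.sub B)) →
              (Car (QRelSet.sub B) → Car (QRelSet.sub A)) → Set ℓ
  IsQGalois A B f g =
    IsQOrderPreserving A B f × IsQOrderPreserving B A g ×
    (∀ x → Underlying≤ A x (g (f x))) ×
    (∀ y → Underlying≤ B (f (g y)) y)

  -- 𝖯X and 𝖯†X.  Elements are pairs (q , μ) with μ : X ⇸ 𝟏_q satisfying
  -- the required conditions.

  module _ (X : QPreord) where
    open QPreord X

    IsP : (q : Carrier) → Rel sub (𝟏 q) → Set ℓ
    IsP q μ = IsQRel sub (𝟏 q) μ × LeR sub (𝟏 q) (comp sub sub (𝟏 q) μ 1♮) μ

    IsP† : (q : Carrier) → Rel (𝟏 q) sub → Set ℓ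
    IsP† q λ' = IsQRel (𝟏 q) sub λ' × LeR (𝟏 q) sub (comp (𝟏 q) sub sub 1♮ λ') λ'

  PElt : QPreord → Set ℓ
  PElt X = Σ Carrier (λ q → Σ (Rel (QPreord.sub X) (𝟏 q)) (IsP X q))

  P†Elt : QPreord → Set ℓ
  P†Elt X = Σ Carrier (λ q → Σ (Rel (𝟏 q) (QPreord.sub X)) (IsP† X q))

  𝖯 : QPreord → QRelSet
  𝖯 X = qrelset (qsubset (PElt X) proj₁)
    (λ { (q , μ , _) (q' , μ' , _) →
         lift↙ (QPreord.sub X) (𝟏 q) (𝟏 q') μ' μ tt tt })

  𝖯† : QPreord → QRelSet
  𝖯† X = qrelset (qsubset (P†Elt X) proj₁)
    (λ { (q , l , _) (q' , l' , _) →
         ext↘ (𝟏 q) (𝟏 q') (QPreord.sub X) l' l tt tt })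

  module _ (X Y : QPreord) (φ : Rel (QPreord.sub X) (QPreord.sub Y)) where
    private
      SX = QPreord.sub X
      SY = QPreord.sub Y

    up-raw : (q : Carrier) → Rel SX (𝟏 q) → Rel (𝟏 q) SY
    up-raw q μ = lift↙ SX (𝟏 q) SY φ μ

    down-raw : (q : Carrier) → Rel (𝟏 q) SY → Rel SX (𝟏 q)
    down-raw q l = ext↘ SX (𝟏 q) SY l φ

    star-raw : (q : Carrier) → Rel SY (𝟏 q) → Rel SX (𝟏 q)
    star-raw q μ' = comp SX SY (𝟏 q) μ' φ

    lowstar-raw : (q : Carrier) → Rel SX (𝟏 q) → Rel SY (𝟏 q)
    lowstar-raw q μ = lift↙ SX SY (𝟏 q) μ φ

    lowdag-raw : (q : Carrier) → Rel (𝟏 q) SY → Rel (𝟏 q) SX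
    lowdag-raw q l = ext↘ (𝟏 q) SX SY φ l

    updag-raw : (q : Carrier) → Rel (𝟏 q) SX → Rel (𝟏 q) SY
    updag-raw q l = comp (𝟏 q) SX SY φ l

  module _ {R R' : Carrier → Set ℓ}
           (Ok : ∀ q → R q → Set ℓ) (Ok' : ∀ q → R' q → Set ℓ)
           (F : ∀ q → R q → R' q) where
    WellDefined : Set ℓ
    WellDefined = ∀ q r → Ok q r → Ok' q (F q r)

    liftMap : WellDefined →
              Σ Carrier (λ q → Σ (R q) (Ok q)) → Σ Carrier (λ q → Σ (R' q) (Ok' q))
    liftMap wd (q , r , ok) = q , F q r , wd q r ok

  f♮ : (X Y : QPreord) → (Car (QPreord.sub X) → Car (QPreord.sub Y)) →
       Rel (QPreord.sub X) (QPreord.sub Y)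
  f♮ X Y f x y = QPreord.1♮ Y (f x) y

  g♮ : (X Y : QPreord) → (Car (QPreord.sub Y) → Car (QPreord.sub X)) →
       Rel (QPreord.sub X) (QPreord.sub Y)
  g♮ X Y g x y = QPreord.1♮ X x (g y)

  module _ (X Y : QPreord) (f : Car (QPreord.sub X) → Car (QPreord.sub Y))
           (g : Car (QPreord.sub Y) → Car (QPreord.sub X)) where

    PolarityCond : Set ℓ
    PolarityCond =
      Σ (WellDefined (IsP X) (IsP† Y) (up-raw X Y (f♮ X Y f))) λ wF →
      Σ (WellDefined (IsP† Y) (IsP X) (down-raw X Y (g♮ X Y g))) λ wG →
      IsQGalois (𝖯 X) (𝖯† Y)
        (liftMap (IsP X) (IsP† Y) (up-raw X Y (f♮ X Y f)) wF)
        (liftMap (IsP† Y) (IsP X) (down-raw X Y (g♮ X Y g)) wG)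

    AxialityCond : Set ℓ
    AxialityCond =
      Σ (WellDefined (IsP Y) (IsP X) (star-raw X Y (f♮ X Y f))) λ wF →
      Σ (WellDefined (IsP X) (IsP Y) (lowstar-raw X Y (g♮ X Y g))) λ wG →
      IsQGalois (𝖯 Y) (𝖯 X)
        (liftMap (IsP Y) (IsP X) (star-raw X Y (f♮ X Y f)) wF)
        (liftMap (IsP X) (IsP Y) (lowstar-raw X Y (g♮ X Y g)) wG)

    DualAxialityCond : Set ℓ
    DualAxialityCond =
      Σ (WellDefined (IsP† Y) (IsP† X) (lowdag-raw X Y (f♮ X Y f))) λ wF →
      Σ (WellDefined (IsP† X) (IsP† Y) (updag-raw X Y (g♮ X Y g))) λ wG →
      IsQGalois (𝖯† Y) (𝖯† X)
        (liftMap (IsP† Y) (IsP† X) (lowdag-raw X Y (f♮ X Y f)) wF)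
        (liftMap (IsP† X) (IsP† Y) (updag-raw X Y (g♮ X Y g)) wG)

-- A 𝔔-Galois connection f ⊣ g is the same as an equality f♮ = g♮ of the graph and the cograph:
-- the unit and the counit turn into the two inequalities by transitivity of 1♮.  It therefore
-- suffices that, for distributors φ, ψ : X ⇸ Y, each of φ↑ ⊣ ψ↓, φ* ⊣ ψ_* and φ_† ⊣ ψ^† holds
-- iff φ = ψ.  For φ = ψ these are the adjunctions given by the universal properties of the
-- residuals ↙ and ↘ of composition, since at level q the hom of 𝖯X (of 𝖯†X) is above q exactly
-- for pointwise inclusion (reverse inclusion).  Conversely, evaluating the unit and the counit at
-- the representables 1♮(-, x), 1♮(y, -) and at the rows and columns of φ and ψ gives back
-- φ ≤ ψ and ψ ≤ φ, as in the Yoneda lemma.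

module Submission where

open import Defs
open import Level using (Level)
open import Data.Product using (Σ; _×_; _,_; proj₁; proj₂)
open import Data.Unit.Polymorphic using (tt)
open import Function.Bundles using (_⇔_; mk⇔; Equivalence)
open import Function.Construct.Composition using (_⇔-∘_)
open import Relation.Binary.Bundles using (Poset)
open import Relation.Binary.PropositionalEquality
  using (_≡_; refl; sym; trans; cong; subst; isEquivalence)
import Relation.Binary.Reasoning.PartialOrder as PartialOrderReasoning

module _ {ℓ : Level} (Q : Quantale ℓ) where
  open Quantale Q

  private variable
    p q r s a b t : Carrier

  ≡⇒≤ : p ≡ q → p ≤ q
  ≡⇒≤ refl = ≤-refl

  ≤-poset : Poset ℓ ℓ ℓ
  ≤-poset = record
    { _≈_ = _≡_
    ; _≤_ = _≤_
    ; isPartialOrder = record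
      { isPreorder = record
        { isEquivalence = isEquivalence ; reflexive = ≡⇒≤ ; trans = ≤-trans }
      ; antisym = ≤-antisym
      }
    }

  open PartialOrderReasoning ≤-poset

  /-intro : p & q ≤ r → p ≤ r / q
  /-intro = Equivalence.to (/-adj _ _ _)

  /-elim : p ≤ r / q → p & q ≤ r
  /-elim = Equivalence.from (/-adj _ _ _)

  \\-intro : p & q ≤ r → q ≤ p \\ r
  \\-intro = Equivalence.to (\\-adj _ _ _)

  \\-elim : q ≤ p \\ r → p & q ≤ r
  \\-elim = Equivalence.from (\\-adj _ _ _)

  /-counit : (r / q) & q ≤ r
  /-counit = /-elim ≤-refl

  \\-counit : p & (p \\ r) ≤ r
  \\-counit = \\-elim ≤-refl

  &-monoˡ : a ≤ b → a & q ≤ b & q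
  &-monoˡ a≤b = /-elim (≤-trans a≤b (/-intro ≤-refl))

  &-monoʳ : a ≤ b → p & a ≤ p & b
  &-monoʳ a≤b = \\-elim (≤-trans a≤b (\\-intro ≤-refl))

  /-monoˡ : a ≤ b → a / q ≤ b / q
  /-monoˡ a≤b = /-intro (≤-trans /-counit a≤b)

  \\-monoʳ : a ≤ b → p \\ a ≤ p \\ b
  \\-monoʳ a≤b = \\-intro (≤-trans \\-counit a≤b)

  &-/-≤ : t & (b / p) ≤ (t & b) / p
  &-/-≤ = /-intro (≤-trans (≡⇒≤ (&-assoc _ _ _)) (&-monoʳ /-counit))

  ≤⇒≤/& : p ≤ b → a ≤ (b / p) & a
  ≤⇒≤/& {p} {b} {a} p≤b = begin
    a            ≡⟨ sym (&-identityˡ a) ⟩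
    e & a        ≤⟨ &-monoˡ (/-intro (≤-trans (≡⇒≤ (&-identityˡ p)) p≤b)) ⟩
    (b / p) & a  ∎

  /&≤&\\ : r & (r \\ a) ≡ a → (b / r) & a ≤ b & (r \\ a)
  /&≤&\\ {r} {a} {b} r&r\\a≡a = begin
    (b / r) & a                ≡⟨ cong ((b / r) &_) (sym r&r\\a≡a) ⟩
    (b / r) & (r & (r \\ a))   ≡⟨ sym (&-assoc _ _ _) ⟩
    ((b / r) & r) & (r \\ a)   ≤⟨ &-monoˡ /-counit ⟩
    b & (r \\ a)               ∎

  &\\≤/& : (b / r) & r ≡ b → b & (r \\ a) ≤ (b / r) & a
  &\\≤/& {b} {r} {a} b/r&r≡b = begin
    b & (r \\ a)               ≡⟨ cong (_& (r \\ a)) (sym b/r&r≡b) ⟩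
    ((b / r) & r) & (r \\ a)   ≡⟨ &-assoc _ _ _ ⟩
    (b / r) & (r & (r \\ a))   ≤⟨ &-monoʳ \\-counit ⟩
    (b / r) & a                ∎

  /&-distrib-⋁ : {I : Set ℓ} {u : I → Carrier} → r & (r \\ a) ≡ a →
                 (⋁ u / r) & a ≤ ⋁ (λ i → u i & (r \\ a))
  /&-distrib-⋁ {u = u} r&r\\a≡a =
    ≤-trans (/&≤&\\ r&r\\a≡a) (≡⇒≤ (&-distribʳ-⋁ _ u))

  DQ-≤ˡ : DQ Q p q a → a ≤ (a / p) & p
  DQ-≤ˡ (a/p&p≡a , _) = ≡⇒≤ (sym a/p&p≡a)

  DQ-≤ʳ : DQ Q p q a → a ≤ q & (q \\ a)
  DQ-≤ʳ (_ , q&q\\a≡a) = ≡⇒≤ (sym q&q\\a≡a)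

  DQ-intro : a ≤ (a / p) & p → a ≤ q & (q \\ a) → DQ Q p q a
  DQ-intro ≤ˡ ≤ʳ = ≤-antisym /-counit ≤ˡ , ≤-antisym \\-counit ≤ʳ

  DQ-⋁ : {I : Set ℓ} (u : I → Carrier) → (∀ i → DQ Q p q (u i)) → DQ Q p q (⋁ u)
  DQ-⋁ u DQ-u = DQ-intro
    (⋁-least u _ λ i → ≤-trans (DQ-≤ˡ (DQ-u i)) (&-monoˡ (/-monoˡ (⋁-ub u i))))
    (⋁-least u _ λ i → ≤-trans (DQ-≤ʳ (DQ-u i)) (&-monoʳ (\\-monoʳ (⋁-ub u i))))

  DQ-/& : DQ Q p r a → DQ Q r s b → DQ Q p s ((b / r) & a)
  DQ-/& {p} {r} {a} {s} {b} (a/p&p≡a , r&r\\a≡a) (b/r&r≡b , s&s\\b≡b) = DQ-intro ≤ˡ ≤ʳ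
    where
    ≤ˡ : (b / r) & a ≤ (((b / r) & a) / p) & p
    ≤ˡ = begin
      (b / r) & a               ≡⟨ cong ((b / r) &_) (sym a/p&p≡a) ⟩
      (b / r) & ((a / p) & p)   ≡⟨ sym (&-assoc _ _ _) ⟩
      ((b / r) & (a / p)) & p   ≤⟨ &-monoˡ &-/-≤ ⟩
      (((b / r) & a) / p) & p   ∎
    s&[s\\b&r\\a]≤ : s & ((s \\ b) & (r \\ a)) ≤ (b / r) & a
    s&[s\\b&r\\a]≤ = begin
      s & ((s \\ b) & (r \\ a))   ≡⟨ sym (&-assoc _ _ _) ⟩
      (s & (s \\ b)) & (r \\ a)   ≡⟨ cong (_& (r \\ a)) s&s\\b≡b ⟩
      b & (r \\ a)                ≤⟨ &\\≤/& b/r&r≡b ⟩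
      (b / r) & a                 ∎
    ≤ʳ : (b / r) & a ≤ s & (s \\ ((b / r) & a))
    ≤ʳ = begin
      (b / r) & a                 ≤⟨ /&≤&\\ r&r\\a≡a ⟩
      b & (r \\ a)                ≡⟨ cong (_& (r \\ a)) (sym s&s\\b≡b) ⟩
      (s & (s \\ b)) & (r \\ a)   ≡⟨ &-assoc _ _ _ ⟩
      s & ((s \\ b) & (r \\ a))   ≤⟨ &-monoʳ (\\-intro s&[s\\b&r\\a]≤) ⟩
      s & (s \\ ((b / r) & a))    ∎

  -- Composition of 𝔔-relations and its residuals

  module _ (X Y Z : QSubset Q) where

    ≤-comp : (ψ : Rel Q Y Z) (φ : Rel Q X Y) {x : Car X} (y : Car Y) {z : Car Z} →
             (ψ y z / ∣ Y ∣ y) & φ x y ≤ comp Q X Y Z ψ φ x z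
    ≤-comp ψ φ y = ⋁-ub (λ y' → (ψ y' _ / ∣ Y ∣ y') & φ _ y') y

    inner≤comp : (ψ : Rel Q Y Z) (φ : Rel Q X Y) {x : Car X} {y : Car Y} {z : Car Z} →
                 ∣ Y ∣ y ≤ ψ y z → φ x y ≤ comp Q X Y Z ψ φ x z
    inner≤comp ψ φ {y = y} |y|≤ψ = ≤-trans (≤⇒≤/& |y|≤ψ) (≤-comp ψ φ y)

    outer≤comp : (ψ : Rel Q Y Z) (φ : Rel Q X Y) {x : Car X} {y : Car Y} {z : Car Z} →
                 IsQRel Q Y Z ψ → ∣ Y ∣ y ≤ φ x y → ψ y z ≤ comp Q X Y Z ψ φ x z
    outer≤comp ψ φ {y = y} {z} ψ-DQ |y|≤φ =
      ≤-trans (DQ-≤ˡ (ψ-DQ y z)) (≤-trans (&-monoʳ |y|≤φ) (≤-comp ψ φ y))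

    comp-monoˡ : {ψ ψ' : Rel Q Y Z} {φ : Rel Q X Y} → LeR Q Y Z ψ ψ' →
                 LeR Q X Z (comp Q X Y Z ψ φ) (comp Q X Y Z ψ' φ)
    comp-monoˡ {ψ} {ψ'} {φ} ψ≤ψ' x z =
      ⋁-least _ _ λ y → ≤-trans (&-monoˡ (/-monoˡ (ψ≤ψ' y z))) (≤-comp ψ' φ y)

    comp-monoʳ : {ψ : Rel Q Y Z} {φ φ' : Rel Q X Y} → LeR Q X Y φ φ' →
                 LeR Q X Z (comp Q X Y Z ψ φ) (comp Q X Y Z ψ φ')
    comp-monoʳ {ψ} {φ} {φ'} φ≤φ' x z =
      ⋁-least _ _ λ y → ≤-trans (&-monoʳ (φ≤φ' x y)) (≤-comp ψ φ' y)

    comp-isQRel : {ψ : Rel Q Y Z} {φ : Rel Q X Y} →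
                  IsQRel Q X Y φ → IsQRel Q Y Z ψ → IsQRel Q X Z (comp Q X Y Z ψ φ)
    comp-isQRel φ-DQ ψ-DQ x z = DQ-⋁ _ λ y → DQ-/& (φ-DQ x y) (ψ-DQ y z)

    lift↙-isQRel : (ξ : Rel Q X Z) (φ : Rel Q X Y) → IsQRel Q Y Z (lift↙ Q X Y Z ξ φ)
    lift↙-isQRel ξ φ y z = DQ-⋁ _ λ (_ , ψ-DQ , _) → ψ-DQ y z

    ext↘-isQRel : (ψ : Rel Q Y Z) (ξ : Rel Q X Z) → IsQRel Q X Y (ext↘ Q X Y Z ψ ξ)
    ext↘-isQRel ψ ξ x y = DQ-⋁ _ λ (_ , φ-DQ , _) → φ-DQ x y

    lift↙-greatest : {ξ : Rel Q X Z} {φ : Rel Q X Y} {ψ : Rel Q Y Z} → IsQRel Q Y Z ψ →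
                     LeR Q X Z (comp Q X Y Z ψ φ) ξ → LeR Q Y Z ψ (lift↙ Q X Y Z ξ φ)
    lift↙-greatest {ψ = ψ} ψ-DQ ψ∘φ≤ξ y z = ⋁-ub (λ s → proj₁ s y z) (ψ , ψ-DQ , ψ∘φ≤ξ)

    ext↘-greatest : {ψ : Rel Q Y Z} {ξ : Rel Q X Z} {φ : Rel Q X Y} → IsQRel Q X Y φ →
                    LeR Q X Z (comp Q X Y Z ψ φ) ξ → LeR Q X Y φ (ext↘ Q X Y Z ψ ξ)
    ext↘-greatest {φ = φ} φ-DQ ψ∘φ≤ξ x y = ⋁-ub (λ s → proj₁ s x y) (φ , φ-DQ , ψ∘φ≤ξ)

    lift↙-cancel : {ξ : Rel Q X Z} {φ : Rel Q X Y} → IsQRel Q X Y φ →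
                   LeR Q X Z (comp Q X Y Z (lift↙ Q X Y Z ξ φ) φ) ξ
    lift↙-cancel {ξ} {φ} φ-DQ x z = ⋁-least _ _ λ y →
      ≤-trans (/&-distrib-⋁ (proj₂ (φ-DQ x y))) (⋁-least _ _ λ (ψ , ψ-DQ , ψ∘φ≤ξ) →
        ≤-trans (&\\≤/& (proj₁ (ψ-DQ y z))) (≤-trans (≤-comp ψ φ y) (ψ∘φ≤ξ x z)))

    ext↘-cancel : {ψ : Rel Q Y Z} {ξ : Rel Q X Z} →
                  LeR Q X Z (comp Q X Y Z ψ (ext↘ Q X Y Z ψ ξ)) ξ
    ext↘-cancel {ψ} {ξ} x z = ⋁-least _ _ λ y →
      ≤-trans (≡⇒≤ (&-distribˡ-⋁ _ _)) (⋁-least _ _ λ (φ , _ , ψ∘φ≤ξ) →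
        ≤-trans (≤-comp ψ φ y) (ψ∘φ≤ξ x z))

  module _ (W X Y Z : QSubset Q) {χ : Rel Q Y Z} {ψ : Rel Q X Y} {φ : Rel Q W X} where

    comp-assoc-≤ : IsQRel Q W X φ → IsQRel Q X Y ψ →
                   LeR Q W Z (comp Q W X Z (comp Q X Y Z χ ψ) φ)
                             (comp Q W Y Z χ (comp Q W X Y ψ φ))
    comp-assoc-≤ φ-DQ ψ-DQ w z = ⋁-least _ _ λ x →
      ≤-trans (/&-distrib-⋁ (proj₂ (φ-DQ w x))) (⋁-least _ _ λ y → begin
        ((χ y z / ∣ Y ∣ y) & ψ x y) & (∣ X ∣ x \\ φ w x)
          ≡⟨ &-assoc _ _ _ ⟩
        (χ y z / ∣ Y ∣ y) & (ψ x y & (∣ X ∣ x \\ φ w x))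
          ≤⟨ &-monoʳ (&\\≤/& (proj₁ (ψ-DQ x y))) ⟩
        (χ y z / ∣ Y ∣ y) & ((ψ x y / ∣ X ∣ x) & φ w x)
          ≤⟨ &-monoʳ (≤-comp W X Y ψ φ x) ⟩
        (χ y z / ∣ Y ∣ y) & comp Q W X Y ψ φ w y
          ≤⟨ ≤-comp W Y Z χ (comp Q W X Y ψ φ) y ⟩
        comp Q W Y Z χ (comp Q W X Y ψ φ) w z ∎)

    comp-assoc-≥ : LeR Q W Z (comp Q W Y Z χ (comp Q W X Y ψ φ))
                             (comp Q W X Z (comp Q X Y Z χ ψ) φ)
    comp-assoc-≥ w z = ⋁-least _ _ λ y →
      ≤-trans (≡⇒≤ (&-distribˡ-⋁ _ _)) (⋁-least _ _ λ x → begin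
        (χ y z / ∣ Y ∣ y) & ((ψ x y / ∣ X ∣ x) & φ w x)
          ≡⟨ sym (&-assoc _ _ _) ⟩
        ((χ y z / ∣ Y ∣ y) & (ψ x y / ∣ X ∣ x)) & φ w x
          ≤⟨ &-monoˡ &-/-≤ ⟩
        (((χ y z / ∣ Y ∣ y) & ψ x y) / ∣ X ∣ x) & φ w x
          ≤⟨ &-monoˡ (/-monoˡ (≤-comp X Y Z χ ψ y)) ⟩
        (comp Q X Y Z χ ψ x z / ∣ X ∣ x) & φ w x
          ≤⟨ ≤-comp W X Z (comp Q X Y Z χ ψ) φ x ⟩
        comp Q W X Z (comp Q X Y Z χ ψ) φ w z ∎)

  LeR-trans : (X Y : QSubset Q) {φ ψ χ : Rel Q X Y} →
              LeR Q X Y φ ψ → LeR Q X Y ψ χ → LeR Q X Y φ χ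
  LeR-trans X Y φ≤ψ ψ≤χ x y = ≤-trans (φ≤ψ x y) (ψ≤χ x y)

  module _ (A B C D : QSubset Q) where

    lift↙-compose : {ξ : Rel Q A D} {μ' : Rel Q A C} {μ : Rel Q A B} →
                    IsQRel Q A B μ → IsQRel Q A C μ' →
                    LeR Q B D (comp Q B C D (lift↙ Q A C D ξ μ') (lift↙ Q A B C μ' μ))
                              (lift↙ Q A B D ξ μ)
    lift↙-compose μ-DQ μ'-DQ =
      lift↙-greatest A B D (comp-isQRel B C D (lift↙-isQRel A B C _ _) (lift↙-isQRel A C D _ _))
        (LeR-trans A D (comp-assoc-≤ A B C D μ-DQ (lift↙-isQRel A B C _ _))
          (LeR-trans A D (comp-monoʳ A C D (lift↙-cancel A B C μ-DQ)) (lift↙-cancel A C D μ'-DQ)))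

    ext↘-compose : {ψ : Rel Q C D} {ψ' : Rel Q B D} {ξ : Rel Q A D} →
                   LeR Q A C (comp Q A B C (ext↘ Q B C D ψ ψ') (ext↘ Q A B D ψ' ξ))
                             (ext↘ Q A C D ψ ξ)
    ext↘-compose =
      ext↘-greatest A C D (comp-isQRel A B C (ext↘-isQRel A B D _ _) (ext↘-isQRel B C D _ _))
        (LeR-trans A D (comp-assoc-≥ A B C D)
          (LeR-trans A D (comp-monoˡ A B D (ext↘-cancel B C D)) (ext↘-cancel A B D)))

    lift↙-precomp : {μ' : Rel Q B D} {μ : Rel Q B C} {φ : Rel Q A B} → IsQRel Q B C μ →
                    LeR Q C D (lift↙ Q B C D μ' μ)
                              (lift↙ Q A C D (comp Q A B D μ' φ) (comp Q A B C μ φ))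
    lift↙-precomp μ-DQ =
      lift↙-greatest A C D (lift↙-isQRel B C D _ _)
        (LeR-trans A D (comp-assoc-≥ A B C D) (comp-monoˡ A B D (lift↙-cancel B C D μ-DQ)))

    ext↘-postcomp : {κ' : Rel Q B C} {κ : Rel Q A C} {ψ : Rel Q C D} → IsQRel Q B C κ' →
                    LeR Q A B (ext↘ Q A B C κ' κ)
                              (ext↘ Q A B D (comp Q B C D ψ κ') (comp Q A C D ψ κ))
    ext↘-postcomp κ'-DQ =
      ext↘-greatest A B D (ext↘-isQRel A B C _ _)
        (LeR-trans A D (comp-assoc-≤ A B C D (ext↘-isQRel A B C _ _) κ'-DQ)
          (comp-monoʳ A C D (ext↘-cancel A B C)))

  lift↙-absorbsˡ : (X B Y : QSubset Q) {φ : Rel Q X Y} {μ : Rel Q X B} {χ : Rel Q Y Y} →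
                   IsQRel Q X B μ → IsQRel Q Y Y χ → LeR Q X Y (comp Q X Y Y χ φ) φ →
                   LeR Q B Y (comp Q B Y Y χ (lift↙ Q X B Y φ μ)) (lift↙ Q X B Y φ μ)
  lift↙-absorbsˡ X B Y μ-DQ χ-DQ χ∘φ≤φ =
    lift↙-greatest X B Y (comp-isQRel B Y Y (lift↙-isQRel X B Y _ _) χ-DQ)
      (LeR-trans X Y (comp-assoc-≤ X B Y Y μ-DQ (lift↙-isQRel X B Y _ _))
        (LeR-trans X Y (comp-monoʳ X Y Y (lift↙-cancel X B Y μ-DQ)) χ∘φ≤φ))

  ext↘-absorbsʳ : (X B Y : QSubset Q) {ψ : Rel Q X Y} {κ : Rel Q B Y} {χ : Rel Q X X} →
                  IsQRel Q X X χ → LeR Q X Y (comp Q X X Y ψ χ) ψ →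
                  LeR Q X B (comp Q X X B (ext↘ Q X B Y κ ψ) χ) (ext↘ Q X B Y κ ψ)
  ext↘-absorbsʳ X B Y χ-DQ ψ∘χ≤ψ =
    ext↘-greatest X B Y (comp-isQRel X X B χ-DQ (ext↘-isQRel X B Y _ _))
      (LeR-trans X Y (comp-assoc-≥ X X B Y)
        (LeR-trans X Y (comp-monoˡ X X Y (ext↘-cancel X B Y)) ψ∘χ≤ψ))

  comp-absorbsʳ : (X Y B : QSubset Q) {φ : Rel Q X Y} {μ : Rel Q Y B} {χ : Rel Q X X} →
                  IsQRel Q X X χ → IsQRel Q X Y φ → LeR Q X Y (comp Q X X Y φ χ) φ →
                  LeR Q X B (comp Q X X B (comp Q X Y B μ φ) χ) (comp Q X Y B μ φ)
  comp-absorbsʳ X Y B χ-DQ φ-DQ φ∘χ≤φ =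
    LeR-trans X B (comp-assoc-≤ X X Y B χ-DQ φ-DQ) (comp-monoʳ X Y B φ∘χ≤φ)

  lift↙-absorbsʳ : (X Y B : QSubset Q) {ψ : Rel Q X Y} {μ : Rel Q X B} {χ : Rel Q Y Y} →
                   IsQRel Q X Y ψ → IsQRel Q Y Y χ → LeR Q X Y (comp Q X Y Y χ ψ) ψ →
                   LeR Q Y B (comp Q Y Y B (lift↙ Q X Y B μ ψ) χ) (lift↙ Q X Y B μ ψ)
  lift↙-absorbsʳ X Y B ψ-DQ χ-DQ χ∘ψ≤ψ =
    lift↙-greatest X Y B (comp-isQRel Y Y B χ-DQ (lift↙-isQRel X Y B _ _))
      (LeR-trans X B (comp-assoc-≤ X Y Y B ψ-DQ χ-DQ)
        (LeR-trans X B (comp-monoʳ X Y B χ∘ψ≤ψ) (lift↙-cancel X Y B ψ-DQ)))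

  ext↘-absorbsˡ : (A X Y : QSubset Q) {φ : Rel Q X Y} {κ : Rel Q A Y} {χ : Rel Q X X} →
                  IsQRel Q X X χ → LeR Q X Y (comp Q X X Y φ χ) φ →
                  LeR Q A X (comp Q A X X χ (ext↘ Q A X Y φ κ)) (ext↘ Q A X Y φ κ)
  ext↘-absorbsˡ A X Y χ-DQ φ∘χ≤φ =
    ext↘-greatest A X Y (comp-isQRel A X X (ext↘-isQRel A X Y _ _) χ-DQ)
      (LeR-trans A Y (comp-assoc-≥ A X X Y)
        (LeR-trans A Y (comp-monoˡ A X Y φ∘χ≤φ) (ext↘-cancel A X Y)))

  comp-absorbsˡ : (A X Y : QSubset Q) {ψ : Rel Q X Y} {κ : Rel Q A X} {χ : Rel Q Y Y} →
                  LeR Q X Y (comp Q X Y Y χ ψ) ψ →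
                  LeR Q A Y (comp Q A Y Y χ (comp Q A X Y ψ κ)) (comp Q A X Y ψ κ)
  comp-absorbsˡ A X Y χ∘ψ≤ψ = LeR-trans A Y (comp-assoc-≥ A X Y Y) (comp-monoˡ A X Y χ∘ψ≤ψ)

  𝟏-id : (q : Carrier) → Rel Q (𝟏 Q q) (𝟏 Q q)
  𝟏-id q _ _ = q

  𝟏-id-isQRel : (q : Carrier) → IsQRel Q (𝟏 Q q) (𝟏 Q q) (𝟏-id q)
  𝟏-id-isQRel q _ _ = DQ-intro (≤⇒≤/& ≤-refl) (begin
    q              ≡⟨ sym (&-identityʳ q) ⟩
    q & e          ≤⟨ &-monoʳ (\\-intro (≡⇒≤ (&-identityʳ q))) ⟩
    q & (q \\ q)   ∎)

  module _ (X : QSubset Q) (q : Carrier) where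

    𝟏-id∘≤ : {μ : Rel Q X (𝟏 Q q)} → IsQRel Q X (𝟏 Q q) μ →
             LeR Q X (𝟏 Q q) (comp Q X (𝟏 Q q) (𝟏 Q q) (𝟏-id q) μ) μ
    𝟏-id∘≤ μ-DQ x _ = ⋁-least _ _ λ s → ≤-trans (/&≤&\\ (proj₂ (μ-DQ x s))) \\-counit

    ∘𝟏-id≤ : {κ : Rel Q (𝟏 Q q) X} →
             LeR Q (𝟏 Q q) X (comp Q (𝟏 Q q) (𝟏 Q q) X κ (𝟏-id q)) κ
    ∘𝟏-id≤ _ _ = ⋁-least _ _ λ _ → /-counit

    q≤lift↙⇔≤ : {μ ν : Rel Q X (𝟏 Q q)} → IsQRel Q X (𝟏 Q q) μ →
                q ≤ lift↙ Q X (𝟏 Q q) (𝟏 Q q) ν μ tt tt ⇔ LeR Q X (𝟏 Q q) μ ν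
    q≤lift↙⇔≤ {μ} μ-DQ = mk⇔
      (λ q≤ x t → ≤-trans (inner≤comp X (𝟏 Q q) (𝟏 Q q) _ μ q≤)
                          (lift↙-cancel X (𝟏 Q q) (𝟏 Q q) μ-DQ x t))
      (λ μ≤ν → lift↙-greatest X (𝟏 Q q) (𝟏 Q q) (𝟏-id-isQRel q)
                 (LeR-trans X (𝟏 Q q) (𝟏-id∘≤ μ-DQ) μ≤ν) tt tt)

    q≤ext↘⇔≤ : {κ' κ : Rel Q (𝟏 Q q) X} → IsQRel Q (𝟏 Q q) X κ' →
               q ≤ ext↘ Q (𝟏 Q q) (𝟏 Q q) X κ' κ tt tt ⇔ LeR Q (𝟏 Q q) X κ' κ
    q≤ext↘⇔≤ {κ'} κ'-DQ = mk⇔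
      (λ q≤ t x → ≤-trans (outer≤comp (𝟏 Q q) (𝟏 Q q) X κ' _ κ'-DQ q≤)
                          (ext↘-cancel (𝟏 Q q) (𝟏 Q q) X t x))
      (λ κ'≤κ → ext↘-greatest (𝟏 Q q) (𝟏 Q q) X (𝟏-id-isQRel q)
                  (LeR-trans (𝟏 Q q) X ∘𝟏-id≤ κ'≤κ) tt tt)

  module _ (Z : QPreord Q) where
    open QPreord Z

    1♮-reflexive : (z : Car sub) → ∣ sub ∣ z ≤ 1♮ z z
    1♮-reflexive z = ≤-trans (⋁-ub _ refl) (1♮-refl z z)

    1♮-transitive : {x y z : Car sub} → (1♮ y z / ∣ sub ∣ y) & 1♮ x y ≤ 1♮ x z
    1♮-transitive {x} {y} {z} = ≤-trans (≤-comp sub sub sub 1♮ 1♮ y) (1♮-trans x z)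

    1♮-antitone : {x x' z : Car sub} → Underlying≤ Q relSet x x' → 1♮ x' z ≤ 1♮ x z
    1♮-antitone {x} {x'} {z} (|x|≡|x'| , |x|≤1♮xx') = ≤-trans
      (outer≤comp sub sub sub 1♮ 1♮ 1♮-rel (subst (_≤ 1♮ x x') |x|≡|x'| |x|≤1♮xx'))
      (1♮-trans x z)

    1♮-monotone : {x z z' : Car sub} → Underlying≤ Q relSet z z' → 1♮ x z ≤ 1♮ x z'
    1♮-monotone {x} {z} {z'} (_ , |z|≤1♮zz') =
      ≤-trans (inner≤comp sub sub sub 1♮ 1♮ |z|≤1♮zz') (1♮-trans x z')

    yoneda : (z : Car sub) → Rel Q sub (𝟏 Q (∣ sub ∣ z))
    yoneda z x _ = 1♮ x z

    coyoneda : (z : Car sub) → Rel Q (𝟏 Q (∣ sub ∣ z)) sub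
    coyoneda z _ x = 1♮ z x

    yoneda-∈𝖯 : (z : Car sub) → IsP Q Z (∣ sub ∣ z) (yoneda z)
    yoneda-∈𝖯 z = (λ x _ → 1♮-rel x z) , (λ x _ → 1♮-trans x z)

    coyoneda-∈𝖯† : (z : Car sub) → IsP† Q Z (∣ sub ∣ z) (coyoneda z)
    coyoneda-∈𝖯† z = (λ _ x → 1♮-rel z x) , (λ _ x → 1♮-trans z x)

  -- Distributors, polarities and axialities

  module _ (X Y : QPreord Q) where
    open QPreord X using () renaming (sub to SX; 1♮ to 1X; 1♮-rel to 1X-rel; relSet to RX)
    open QPreord Y using () renaming (sub to SY; 1♮ to 1Y; 1♮-rel to 1Y-rel; relSet to RY)

    -- Equivalent to the single condition 1♮_Y ∘ φ ∘ 1♮_X ≤ φ, since both 1♮ contain the identity.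
    record IsDistributor (φ : Rel Q SX SY) : Set ℓ where
      field
        isQRel   : IsQRel Q SX SY φ
        absorbsˡ : LeR Q SX SY (comp Q SX SY SY 1Y φ) φ
        absorbsʳ : LeR Q SX SY (comp Q SX SX SY φ 1X) φ

    open IsDistributor using (isQRel)

    infix 4 _⊑_ _≃_

    _⊑_ : Rel Q SX SY → Rel Q SX SY → Set ℓ
    _⊑_ = LeR Q SX SY

    _≃_ : Rel Q SX SY → Rel Q SX SY → Set ℓ
    φ ≃ ψ = φ ⊑ ψ × ψ ⊑ φ

    column : Rel Q SX SY → (y : Car SY) → Rel Q SX (𝟏 Q (∣ SY ∣ y))
    column φ y x _ = φ x y

    row : Rel Q SX SY → (x : Car SX) → Rel Q (𝟏 Q (∣ SX ∣ x)) SY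
    row φ x _ y = φ x y

    module _ {φ : Rel Q SX SY} (φ-dist : IsDistributor φ) where
      open IsDistributor φ-dist using (absorbsˡ; absorbsʳ)

      column-∈𝖯 : (y : Car SY) → IsP Q X (∣ SY ∣ y) (column φ y)
      column-∈𝖯 y = (λ x _ → isQRel φ-dist x y) , (λ x _ → absorbsʳ x y)

      row-∈𝖯† : (x : Car SX) → IsP† Q Y (∣ SX ∣ x) (row φ x)
      row-∈𝖯† x = (λ _ y → isQRel φ-dist x y) , (λ _ y → absorbsˡ x y)

      row∘yoneda≤φ : (x : Car SX) → comp Q SX (𝟏 Q (∣ SX ∣ x)) SY (row φ x) (yoneda X x) ⊑ φ
      row∘yoneda≤φ x x' y = ⋁-least _ _ λ _ → ≤-trans (≤-comp SX SX SY φ 1X x) (absorbsʳ x' y)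

      coyoneda∘column≤φ : (y : Car SY) →
                          comp Q SX (𝟏 Q (∣ SY ∣ y)) SY (coyoneda Y y) (column φ y) ⊑ φ
      coyoneda∘column≤φ y x y' =
        ⋁-least _ _ λ _ → ≤-trans (≤-comp SX SY SY 1Y φ y) (absorbsˡ x y')

      φ∘coyoneda≤row : (x : Car SX) →
                       LeR Q (𝟏 Q (∣ SX ∣ x)) SY
                         (comp Q (𝟏 Q (∣ SX ∣ x)) SX SY φ (coyoneda X x)) (row φ x)
      φ∘coyoneda≤row x _ = absorbsʳ x

      yoneda∘φ≤column : (y : Car SY) →
                        LeR Q SX (𝟏 Q (∣ SY ∣ y))
                          (comp Q SX SY (𝟏 Q (∣ SY ∣ y)) (yoneda Y y) φ) (column φ y)
      yoneda∘φ≤column y x _ = absorbsˡ x y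

    IsPolarity : Rel Q SX SY → Rel Q SX SY → Set ℓ
    IsPolarity φ ψ =
      Σ (WellDefined Q (IsP Q X) (IsP† Q Y) (up-raw Q X Y φ)) λ up-wd →
      Σ (WellDefined Q (IsP† Q Y) (IsP Q X) (down-raw Q X Y ψ)) λ down-wd →
      IsQGalois Q (𝖯 Q X) (𝖯† Q Y)
        (liftMap Q (IsP Q X) (IsP† Q Y) (up-raw Q X Y φ) up-wd)
        (liftMap Q (IsP† Q Y) (IsP Q X) (down-raw Q X Y ψ) down-wd)

    module _ {φ : Rel Q SX SY} (φ-dist : IsDistributor φ) where
      open IsDistributor φ-dist using (absorbsˡ; absorbsʳ)

      up-wellDefined : WellDefined Q (IsP Q X) (IsP† Q Y) (up-raw Q X Y φ)
      up-wellDefined q μ (μ-DQ , _) =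
        lift↙-isQRel SX (𝟏 Q q) SY φ μ , lift↙-absorbsˡ SX (𝟏 Q q) SY μ-DQ 1Y-rel absorbsˡ

      up-preservesOrder : IsQOrderPreserving Q (𝖯 Q X) (𝖯† Q Y)
                            (liftMap Q (IsP Q X) (IsP† Q Y) (up-raw Q X Y φ) up-wellDefined)
      up-preservesOrder = (λ _ → refl) , λ { (q , μ , μ-DQ , _) (q' , μ' , μ'-DQ , _) →
        ext↘-greatest (𝟏 Q q) (𝟏 Q q') SY (lift↙-isQRel SX (𝟏 Q q) (𝟏 Q q') μ' μ)
          (lift↙-compose SX (𝟏 Q q) (𝟏 Q q') SY μ-DQ μ'-DQ) tt tt }

      down-wellDefined : WellDefined Q (IsP† Q Y) (IsP Q X) (down-raw Q X Y φ)
      down-wellDefined q κ _ =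
        ext↘-isQRel SX (𝟏 Q q) SY κ φ , ext↘-absorbsʳ SX (𝟏 Q q) SY 1X-rel absorbsʳ

      down-preservesOrder : IsQOrderPreserving Q (𝖯† Q Y) (𝖯 Q X)
                              (liftMap Q (IsP† Q Y) (IsP Q X) (down-raw Q X Y φ) down-wellDefined)
      down-preservesOrder = (λ _ → refl) , λ { (q , κ , _) (q' , κ' , _) →
        lift↙-greatest SX (𝟏 Q q) (𝟏 Q q') (ext↘-isQRel (𝟏 Q q) (𝟏 Q q') SY κ' κ)
          (ext↘-compose SX (𝟏 Q q) (𝟏 Q q') SY) tt tt }

    ≃⇒polarity : {φ ψ : Rel Q SX SY} → IsDistributor φ → IsDistributor ψ →
                 φ ≃ ψ → IsPolarity φ ψ
    ≃⇒polarity φ-dist ψ-dist (φ⊑ψ , ψ⊑φ) =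
        up-wellDefined φ-dist , down-wellDefined ψ-dist
      , up-preservesOrder φ-dist , down-preservesOrder ψ-dist
      , (λ { (q , μ , μ-DQ , _) → refl , Equivalence.from (q≤lift↙⇔≤ SX q μ-DQ)
               (ext↘-greatest SX (𝟏 Q q) SY μ-DQ
                 (LeR-trans SX SY (lift↙-cancel SX (𝟏 Q q) SY μ-DQ) φ⊑ψ)) })
      , (λ { (q , κ , κ-DQ , _) → refl , Equivalence.from (q≤ext↘⇔≤ SY q κ-DQ)
               (lift↙-greatest SX (𝟏 Q q) SY κ-DQ
                 (LeR-trans SX SY (ext↘-cancel SX (𝟏 Q q) SY) ψ⊑φ)) })

    polarity⇒≃ : {φ ψ : Rel Q SX SY} → IsDistributor φ → IsDistributor ψ →
                 IsPolarity φ ψ → φ ≃ ψ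
    polarity⇒≃ {φ} {ψ} φ-dist ψ-dist (_ , _ , _ , _ , unit , counit) = φ⊑ψ , ψ⊑φ
      where
      φ⊑ψ : φ ⊑ ψ
      φ⊑ψ x y = begin
        φ x y
          ≤⟨ row≤φ↑ tt y ⟩
        φ↑ tt y
          ≤⟨ outer≤comp SX 𝟏ₓ SY φ↑ ψ↓φ↑ (lift↙-isQRel SX 𝟏ₓ SY φ _)
               (≤-trans (1♮-reflexive X x) (yoneda≤ψ↓φ↑ x tt)) ⟩
        comp Q SX 𝟏ₓ SY φ↑ ψ↓φ↑ x y
          ≤⟨ ext↘-cancel SX 𝟏ₓ SY x y ⟩
        ψ x y ∎
        where
        𝟏ₓ : QSubset Q
        𝟏ₓ = 𝟏 Q (∣ SX ∣ x)
        φ↑ : Rel Q 𝟏ₓ SY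
        φ↑ = up-raw Q X Y φ (∣ SX ∣ x) (yoneda X x)
        ψ↓φ↑ : Rel Q SX 𝟏ₓ
        ψ↓φ↑ = down-raw Q X Y ψ (∣ SX ∣ x) φ↑
        row≤φ↑ : LeR Q 𝟏ₓ SY (row φ x) φ↑
        row≤φ↑ = lift↙-greatest SX 𝟏ₓ SY (proj₁ (row-∈𝖯† φ-dist x)) (row∘yoneda≤φ φ-dist x)
        yoneda≤ψ↓φ↑ : LeR Q SX 𝟏ₓ (yoneda X x) ψ↓φ↑
        yoneda≤ψ↓φ↑ = Equivalence.to (q≤lift↙⇔≤ SX _ (proj₁ (yoneda-∈𝖯 X x)))
                        (proj₂ (unit (_ , yoneda X x , yoneda-∈𝖯 X x)))
      ψ⊑φ : ψ ⊑ φ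
      ψ⊑φ x y = begin
        ψ x y
          ≤⟨ column≤ψ↓ x tt ⟩
        ψ↓ x tt
          ≤⟨ inner≤comp SX 𝟏ʸ SY φ↑ψ↓ ψ↓ (≤-trans (1♮-reflexive Y y) (coyoneda≤φ↑ψ↓ tt y)) ⟩
        comp Q SX 𝟏ʸ SY φ↑ψ↓ ψ↓ x y
          ≤⟨ lift↙-cancel SX 𝟏ʸ SY (ext↘-isQRel SX 𝟏ʸ SY _ ψ) x y ⟩
        φ x y ∎
        where
        𝟏ʸ : QSubset Q
        𝟏ʸ = 𝟏 Q (∣ SY ∣ y)
        ψ↓ : Rel Q SX 𝟏ʸ
        ψ↓ = down-raw Q X Y ψ (∣ SY ∣ y) (coyoneda Y y)
        φ↑ψ↓ : Rel Q 𝟏ʸ SY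
        φ↑ψ↓ = up-raw Q X Y φ (∣ SY ∣ y) ψ↓
        column≤ψ↓ : LeR Q SX 𝟏ʸ (column ψ y) ψ↓
        column≤ψ↓ =
          ext↘-greatest SX 𝟏ʸ SY (proj₁ (column-∈𝖯 ψ-dist y)) (coyoneda∘column≤φ ψ-dist y)
        coyoneda≤φ↑ψ↓ : LeR Q 𝟏ʸ SY (coyoneda Y y) φ↑ψ↓
        coyoneda≤φ↑ψ↓ = Equivalence.to (q≤ext↘⇔≤ SY _ (proj₁ (coyoneda-∈𝖯† Y y)))
                          (proj₂ (counit (_ , coyoneda Y y , coyoneda-∈𝖯† Y y)))

    IsAxiality : Rel Q SX SY → Rel Q SX SY → Set ℓ
    IsAxiality φ ψ =
      Σ (WellDefined Q (IsP Q Y) (IsP Q X) (star-raw Q X Y φ)) λ star-wd →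
      Σ (WellDefined Q (IsP Q X) (IsP Q Y) (lowstar-raw Q X Y ψ)) λ lowstar-wd →
      IsQGalois Q (𝖯 Q Y) (𝖯 Q X)
        (liftMap Q (IsP Q Y) (IsP Q X) (star-raw Q X Y φ) star-wd)
        (liftMap Q (IsP Q X) (IsP Q Y) (lowstar-raw Q X Y ψ) lowstar-wd)

    module _ {φ : Rel Q SX SY} (φ-dist : IsDistributor φ) where
      open IsDistributor φ-dist using (absorbsˡ; absorbsʳ)

      star-wellDefined : WellDefined Q (IsP Q Y) (IsP Q X) (star-raw Q X Y φ)
      star-wellDefined q μ (μ-DQ , _) =
        comp-isQRel SX SY (𝟏 Q q) (isQRel φ-dist) μ-DQ ,
        comp-absorbsʳ SX SY (𝟏 Q q) 1X-rel (isQRel φ-dist) absorbsʳ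

      star-preservesOrder : IsQOrderPreserving Q (𝖯 Q Y) (𝖯 Q X)
                              (liftMap Q (IsP Q Y) (IsP Q X) (star-raw Q X Y φ) star-wellDefined)
      star-preservesOrder = (λ _ → refl) , λ { (q , μ , μ-DQ , _) (q' , μ' , _) →
        lift↙-precomp SX SY (𝟏 Q q) (𝟏 Q q') μ-DQ tt tt }

      lowstar-wellDefined : WellDefined Q (IsP Q X) (IsP Q Y) (lowstar-raw Q X Y φ)
      lowstar-wellDefined q μ _ =
        lift↙-isQRel SX SY (𝟏 Q q) μ φ ,
        lift↙-absorbsʳ SX SY (𝟏 Q q) (isQRel φ-dist) 1Y-rel absorbsˡ

      lowstar-preservesOrder :
        IsQOrderPreserving Q (𝖯 Q X) (𝖯 Q Y)
          (liftMap Q (IsP Q X) (IsP Q Y) (lowstar-raw Q X Y φ) lowstar-wellDefined)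
      lowstar-preservesOrder = (λ _ → refl) , λ { (q , μ , μ-DQ , _) (q' , μ' , _) →
        lift↙-greatest SY (𝟏 Q q) (𝟏 Q q') (lift↙-isQRel SX (𝟏 Q q) (𝟏 Q q') μ' μ)
          (lift↙-compose SX SY (𝟏 Q q) (𝟏 Q q') (isQRel φ-dist) μ-DQ) tt tt }

    ≃⇒axiality : {φ ψ : Rel Q SX SY} → IsDistributor φ → IsDistributor ψ →
                 φ ≃ ψ → IsAxiality φ ψ
    ≃⇒axiality φ-dist ψ-dist (φ⊑ψ , ψ⊑φ) =
        star-wellDefined φ-dist , lowstar-wellDefined ψ-dist
      , star-preservesOrder φ-dist , lowstar-preservesOrder ψ-dist
      , (λ { (q , μ , μ-DQ , _) → refl , Equivalence.from (q≤lift↙⇔≤ SY q μ-DQ)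
               (lift↙-greatest SX SY (𝟏 Q q) μ-DQ (comp-monoʳ SX SY (𝟏 Q q) ψ⊑φ)) })
      , (λ { (q , μ , μ-DQ , _) → refl , Equivalence.from
               (q≤lift↙⇔≤ SX q (comp-isQRel SX SY (𝟏 Q q) (isQRel φ-dist)
                                  (lift↙-isQRel SX SY (𝟏 Q q) μ _)))
               (LeR-trans SX (𝟏 Q q) (comp-monoʳ SX SY (𝟏 Q q) φ⊑ψ)
                 (lift↙-cancel SX SY (𝟏 Q q) (isQRel ψ-dist))) })

    axiality⇒≃ : {φ ψ : Rel Q SX SY} → IsDistributor φ → IsDistributor ψ →
                 IsAxiality φ ψ → φ ≃ ψ
    axiality⇒≃ {φ} {ψ} φ-dist ψ-dist (star-wd , lowstar-wd , _ , _ , unit , counit) =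
      φ⊑ψ , ψ⊑φ
      where
      φ⊑ψ : φ ⊑ ψ
      φ⊑ψ x y = begin
        φ x y
          ≤⟨ inner≤comp SX SY 𝟏ʸ ψ↙ φ (≤-trans (1♮-reflexive Y y) (yoneda≤ψ↙ y tt)) ⟩
        comp Q SX SY 𝟏ʸ ψ↙ φ x tt
          ≤⟨ φ*ψ↙≤column x tt ⟩
        ψ x y ∎
        where
        𝟏ʸ : QSubset Q
        𝟏ʸ = 𝟏 Q (∣ SY ∣ y)
        ψ↙ : Rel Q SY 𝟏ʸ
        ψ↙ = lowstar-raw Q X Y ψ (∣ SY ∣ y) (column ψ y)
        yoneda≤ψ↙ : LeR Q SY 𝟏ʸ (yoneda Y y) ψ↙
        yoneda≤ψ↙ = lift↙-greatest SX SY 𝟏ʸ (proj₁ (yoneda-∈𝖯 Y y)) (yoneda∘φ≤column ψ-dist y)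
        φ*ψ↙≤column : LeR Q SX 𝟏ʸ (comp Q SX SY 𝟏ʸ ψ↙ φ) (column ψ y)
        φ*ψ↙≤column = Equivalence.to
          (q≤lift↙⇔≤ SX _ (proj₁ (star-wd _ _ (lowstar-wd _ _ (column-∈𝖯 ψ-dist y)))))
          (proj₂ (counit (_ , column ψ y , column-∈𝖯 ψ-dist y)))
      ψ⊑φ : ψ ⊑ φ
      ψ⊑φ x y = begin
        ψ x y
          ≤⟨ inner≤comp SX SY 𝟏ʸ ψ↙φ* ψ (≤-trans (1♮-reflexive Y y) (yoneda≤ψ↙φ* y tt)) ⟩
        comp Q SX SY 𝟏ʸ ψ↙φ* ψ x tt
          ≤⟨ lift↙-cancel SX SY 𝟏ʸ (isQRel ψ-dist) x tt ⟩
        comp Q SX SY 𝟏ʸ (yoneda Y y) φ x tt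
          ≤⟨ yoneda∘φ≤column φ-dist y x tt ⟩
        φ x y ∎
        where
        𝟏ʸ : QSubset Q
        𝟏ʸ = 𝟏 Q (∣ SY ∣ y)
        ψ↙φ* : Rel Q SY 𝟏ʸ
        ψ↙φ* = lowstar-raw Q X Y ψ (∣ SY ∣ y) (star-raw Q X Y φ (∣ SY ∣ y) (yoneda Y y))
        yoneda≤ψ↙φ* : LeR Q SY 𝟏ʸ (yoneda Y y) ψ↙φ*
        yoneda≤ψ↙φ* = Equivalence.to (q≤lift↙⇔≤ SY _ (proj₁ (yoneda-∈𝖯 Y y)))
                        (proj₂ (unit (_ , yoneda Y y , yoneda-∈𝖯 Y y)))

    IsDualAxiality : Rel Q SX SY → Rel Q SX SY → Set ℓ
    IsDualAxiality φ ψ =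
      Σ (WellDefined Q (IsP† Q Y) (IsP† Q X) (lowdag-raw Q X Y φ)) λ lowdag-wd →
      Σ (WellDefined Q (IsP† Q X) (IsP† Q Y) (updag-raw Q X Y ψ)) λ updag-wd →
      IsQGalois Q (𝖯† Q Y) (𝖯† Q X)
        (liftMap Q (IsP† Q Y) (IsP† Q X) (lowdag-raw Q X Y φ) lowdag-wd)
        (liftMap Q (IsP† Q X) (IsP† Q Y) (updag-raw Q X Y ψ) updag-wd)

    module _ {φ : Rel Q SX SY} (φ-dist : IsDistributor φ) where
      open IsDistributor φ-dist using (absorbsˡ; absorbsʳ)

      lowdag-wellDefined : WellDefined Q (IsP† Q Y) (IsP† Q X) (lowdag-raw Q X Y φ)
      lowdag-wellDefined q κ _ =
        ext↘-isQRel (𝟏 Q q) SX SY φ κ , ext↘-absorbsˡ (𝟏 Q q) SX SY 1X-rel absorbsʳ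

      lowdag-preservesOrder :
        IsQOrderPreserving Q (𝖯† Q Y) (𝖯† Q X)
          (liftMap Q (IsP† Q Y) (IsP† Q X) (lowdag-raw Q X Y φ) lowdag-wellDefined)
      lowdag-preservesOrder = (λ _ → refl) , λ { (q , κ , _) (q' , κ' , _) →
        ext↘-greatest (𝟏 Q q) (𝟏 Q q') SX (ext↘-isQRel (𝟏 Q q) (𝟏 Q q') SY κ' κ)
          (ext↘-compose (𝟏 Q q) (𝟏 Q q') SX SY) tt tt }

      updag-wellDefined : WellDefined Q (IsP† Q X) (IsP† Q Y) (updag-raw Q X Y φ)
      updag-wellDefined q κ (κ-DQ , _) =
        comp-isQRel (𝟏 Q q) SX SY κ-DQ (isQRel φ-dist) , comp-absorbsˡ (𝟏 Q q) SX SY absorbsˡ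

      updag-preservesOrder :
        IsQOrderPreserving Q (𝖯† Q X) (𝖯† Q Y)
          (liftMap Q (IsP† Q X) (IsP† Q Y) (updag-raw Q X Y φ) updag-wellDefined)
      updag-preservesOrder = (λ _ → refl) , λ { (q , κ , _) (q' , κ' , κ'-DQ , _) →
        ext↘-postcomp (𝟏 Q q) (𝟏 Q q') SX SY κ'-DQ tt tt }

    ≃⇒dualAxiality : {φ ψ : Rel Q SX SY} → IsDistributor φ → IsDistributor ψ →
                     φ ≃ ψ → IsDualAxiality φ ψ
    ≃⇒dualAxiality φ-dist ψ-dist (φ⊑ψ , ψ⊑φ) =
        lowdag-wellDefined φ-dist , updag-wellDefined ψ-dist
      , lowdag-preservesOrder φ-dist , updag-preservesOrder ψ-dist
      , (λ { (q , κ , κ-DQ , _) → refl , Equivalence.from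
               (q≤ext↘⇔≤ SY q (comp-isQRel (𝟏 Q q) SX SY (ext↘-isQRel (𝟏 Q q) SX SY _ κ)
                                 (isQRel ψ-dist)))
               (LeR-trans (𝟏 Q q) SY (comp-monoˡ (𝟏 Q q) SX SY ψ⊑φ)
                 (ext↘-cancel (𝟏 Q q) SX SY)) })
      , (λ { (q , κ , κ-DQ , _) → refl , Equivalence.from (q≤ext↘⇔≤ SX q κ-DQ)
               (ext↘-greatest (𝟏 Q q) SX SY κ-DQ (comp-monoˡ (𝟏 Q q) SX SY φ⊑ψ)) })

    dualAxiality⇒≃ : {φ ψ : Rel Q SX SY} → IsDistributor φ → IsDistributor ψ →
                     IsDualAxiality φ ψ → φ ≃ ψ
    dualAxiality⇒≃ {φ} {ψ} φ-dist ψ-dist (lowdag-wd , updag-wd , _ , _ , unit , counit) =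
      φ⊑ψ , ψ⊑φ
      where
      φ⊑ψ : φ ⊑ ψ
      φ⊑ψ x y = begin
        φ x y
          ≤⟨ outer≤comp 𝟏ₓ SX SY φ φ↘ψ† (isQRel φ-dist)
               (≤-trans (1♮-reflexive X x) (coyoneda≤φ↘ψ† tt x)) ⟩
        comp Q 𝟏ₓ SX SY φ φ↘ψ† tt y
          ≤⟨ ext↘-cancel 𝟏ₓ SX SY tt y ⟩
        comp Q 𝟏ₓ SX SY ψ (coyoneda X x) tt y
          ≤⟨ φ∘coyoneda≤row ψ-dist x tt y ⟩
        ψ x y ∎
        where
        𝟏ₓ : QSubset Q
        𝟏ₓ = 𝟏 Q (∣ SX ∣ x)
        φ↘ψ† : Rel Q 𝟏ₓ SX
        φ↘ψ† = lowdag-raw Q X Y φ (∣ SX ∣ x) (updag-raw Q X Y ψ (∣ SX ∣ x) (coyoneda X x))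
        coyoneda≤φ↘ψ† : LeR Q 𝟏ₓ SX (coyoneda X x) φ↘ψ†
        coyoneda≤φ↘ψ† = Equivalence.to (q≤ext↘⇔≤ SX _ (proj₁ (coyoneda-∈𝖯† X x)))
                          (proj₂ (counit (_ , coyoneda X x , coyoneda-∈𝖯† X x)))
      ψ⊑φ : ψ ⊑ φ
      ψ⊑φ x y = begin
        ψ x y
          ≤⟨ outer≤comp 𝟏ₓ SX SY ψ φ↘ (isQRel ψ-dist)
               (≤-trans (1♮-reflexive X x) (coyoneda≤φ↘ tt x)) ⟩
        comp Q 𝟏ₓ SX SY ψ φ↘ tt y
          ≤⟨ ψ†φ↘≤row tt y ⟩
        φ x y ∎
        where
        𝟏ₓ : QSubset Q
        𝟏ₓ = 𝟏 Q (∣ SX ∣ x)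
        φ↘ : Rel Q 𝟏ₓ SX
        φ↘ = lowdag-raw Q X Y φ (∣ SX ∣ x) (row φ x)
        coyoneda≤φ↘ : LeR Q 𝟏ₓ SX (coyoneda X x) φ↘
        coyoneda≤φ↘ =
          ext↘-greatest 𝟏ₓ SX SY (proj₁ (coyoneda-∈𝖯† X x)) (φ∘coyoneda≤row φ-dist x)
        ψ†φ↘≤row : LeR Q 𝟏ₓ SY (comp Q 𝟏ₓ SX SY ψ φ↘) (row φ x)
        ψ†φ↘≤row = Equivalence.to
          (q≤ext↘⇔≤ SY _ (proj₁ (updag-wd _ _ (lowdag-wd _ _ (row-∈𝖯† φ-dist x)))))
          (proj₂ (unit (_ , row φ x , row-∈𝖯† φ-dist x)))

    ≃⇔polarity : {φ ψ : Rel Q SX SY} → IsDistributor φ → IsDistributor ψ →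
                 φ ≃ ψ ⇔ IsPolarity φ ψ
    ≃⇔polarity φ-dist ψ-dist = mk⇔ (≃⇒polarity φ-dist ψ-dist) (polarity⇒≃ φ-dist ψ-dist)

    ≃⇔axiality : {φ ψ : Rel Q SX SY} → IsDistributor φ → IsDistributor ψ →
                 φ ≃ ψ ⇔ IsAxiality φ ψ
    ≃⇔axiality φ-dist ψ-dist = mk⇔ (≃⇒axiality φ-dist ψ-dist) (axiality⇒≃ φ-dist ψ-dist)

    ≃⇔dualAxiality : {φ ψ : Rel Q SX SY} → IsDistributor φ → IsDistributor ψ →
                     φ ≃ ψ ⇔ IsDualAxiality φ ψ
    ≃⇔dualAxiality φ-dist ψ-dist =
      mk⇔ (≃⇒dualAxiality φ-dist ψ-dist) (dualAxiality⇒≃ φ-dist ψ-dist)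

    -- Graph and cograph of a pair of maps

    f♮-isDistributor : {f : Car SX → Car SY} → IsQOrderPreserving Q RX RY f →
                       IsDistributor (f♮ Q X Y f)
    f♮-isDistributor {f} (|f|≡ , f-mono) = record
      { isQRel   = λ x y → subst (λ p → DQ Q p (∣ SY ∣ y) (1Y (f x) y)) (|f|≡ x) (1Y-rel (f x) y)
      ; absorbsˡ = λ x → QPreord.1♮-trans Y (f x)
      ; absorbsʳ = λ x y → ⋁-least _ _ λ x' → begin
          (1Y (f x') y / ∣ SX ∣ x') & 1X x x'
            ≤⟨ &-monoʳ (f-mono x x') ⟩
          (1Y (f x') y / ∣ SX ∣ x') & 1Y (f x) (f x')
            ≡⟨ cong (λ p → (1Y (f x') y / p) & _) (sym (|f|≡ x')) ⟩
          (1Y (f x') y / ∣ SY ∣ (f x')) & 1Y (f x) (f x')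
            ≤⟨ 1♮-transitive Y ⟩
          1Y (f x) y ∎
      }

    g♮-isDistributor : {g : Car SY → Car SX} → IsQOrderPreserving Q RY RX g →
                       IsDistributor (g♮ Q X Y g)
    g♮-isDistributor {g} (|g|≡ , g-mono) = record
      { isQRel   = λ x y → subst (λ p → DQ Q (∣ SX ∣ x) p (1X x (g y))) (|g|≡ y) (1X-rel x (g y))
      ; absorbsˡ = λ x y → ⋁-least _ _ λ y' → begin
          (1Y y' y / ∣ SY ∣ y') & 1X x (g y')
            ≤⟨ &-monoˡ (/-monoˡ (g-mono y' y)) ⟩
          (1X (g y') (g y) / ∣ SY ∣ y') & 1X x (g y')
            ≡⟨ cong (λ p → (1X (g y') (g y) / p) & _) (sym (|g|≡ y')) ⟩
          (1X (g y') (g y) / ∣ SX ∣ (g y')) & 1X x (g y')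
            ≤⟨ 1♮-transitive X ⟩
          1X x (g y) ∎
      ; absorbsʳ = λ x y → QPreord.1♮-trans X x (g y)
      }

    galois⇔f♮≃g♮ : {f : Car SX → Car SY} {g : Car SY → Car SX} →
                   IsQOrderPreserving Q RX RY f → IsQOrderPreserving Q RY RX g →
                   IsQGalois Q RX RY f g ⇔ f♮ Q X Y f ≃ g♮ Q X Y g
    galois⇔f♮≃g♮ {f} {g} f-op@(|f|≡ , f-mono) g-op@(|g|≡ , g-mono) = mk⇔
      (λ (_ , _ , unit , counit) →
          (λ x y → ≤-trans (g-mono (f x) y) (1♮-antitone X (unit x)))
        , (λ x y → ≤-trans (f-mono x (g y)) (1♮-monotone Y (counit y))))
      (λ (f♮⊑g♮ , g♮⊑f♮) → f-op , g-op , unit f♮⊑g♮ , counit g♮⊑f♮)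
      where
      unit : f♮ Q X Y f ⊑ g♮ Q X Y g → ∀ x → Underlying≤ Q RX x (g (f x))
      unit f♮⊑g♮ x = sym (trans (|g|≡ (f x)) (|f|≡ x))
                   , ≤-trans (≡⇒≤ (sym (|f|≡ x))) (≤-trans (1♮-reflexive Y (f x)) (f♮⊑g♮ x (f x)))
      counit : g♮ Q X Y g ⊑ f♮ Q X Y f → ∀ y → Underlying≤ Q RY (f (g y)) y
      counit g♮⊑f♮ y = trans (|f|≡ (g y)) (|g|≡ y)
                     , ≤-trans (≡⇒≤ (|f|≡ (g y))) (≤-trans (1♮-reflexive X (g y)) (g♮⊑f♮ (g y) y))

theorem4p22 : {ℓ : Level} (Q : Quantale ℓ) → Nontrivial Q →
    (X Y : QPreord Q)
    (f : Car (QPreord.sub X) → Car (QPreord.sub Y))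
    (g : Car (QPreord.sub Y) → Car (QPreord.sub X)) →
    IsQOrderPreserving Q (QPreord.relSet X) (QPreord.relSet Y) f →
    IsQOrderPreserving Q (QPreord.relSet Y) (QPreord.relSet X) g →
    (IsQGalois Q (QPreord.relSet X) (QPreord.relSet Y) f g ⇔ PolarityCond Q X Y f g)
    × (IsQGalois Q (QPreord.relSet X) (QPreord.relSet Y) f g ⇔ AxialityCond Q X Y f g)
    × (IsQGalois Q (QPreord.relSet X) (QPreord.relSet Y) f g ⇔ DualAxialityCond Q X Y f g)
theorem4p22 Q _ X Y f g f-op g-op =
    ≃⇔polarity Q X Y f♮-dist g♮-dist ⇔-∘ galois⇔f♮≃g♮ Q X Y f-op g-op
  , ≃⇔axiality Q X Y f♮-dist g♮-dist ⇔-∘ galois⇔f♮≃g♮ Q X Y f-op g-op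
  , ≃⇔dualAxiality Q X Y f♮-dist g♮-dist ⇔-∘ galois⇔f♮≃g♮ Q X Y f-op g-op
  where
  f♮-dist : IsDistributor Q X Y (f♮ Q X Y f)
  f♮-dist = f♮-isDistributor Q X Y f-op
  g♮-dist : IsDistributor Q X Y (g♮ Q X Y g)
  g♮-dist = g♮-isDistributor Q X Y g-op
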